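{- Let $k$ be a positive integer, let $c_u\in\mathbb{Z}_{\ge 0}$, and let $v_1,\dots,v_{d}$ be $d$ items, each $v$ equipped with a vector $(g(v)_1,\dots,g(v)_k)$ of nonnegative integers that is nondecreasing in its index. Consider the Non-Standard Multiple-Choice Knapsack Problem (NS-MCKP): maximize $k+\sum_{j=1}^{d}\sum_{i=1}^{k} g(v_j)_i\, x_{j}^i$ subject to $\sum_{j=1}^{d}\sum_{i=1}^{k} i\, x_{j}^i\le c_u$, $\;\sum_{i=1}^k x_{j}^i\le 1$ for all $j\in\{1,\dots,d\}$, and $x_{j}^i\in\{0,1\}$ for all $j,i$. Then this NS-MCKP can be solved in time $\mathcal O(k^2 d^2)$.
   Context: In the paper, $u$ is a vertex of a rooted tree $G$, $v_1,\dots,v_d$ are the children of $u$ (so $d=n_G(u)$, the number of children of $u$), $c_u$ is the capacity of $u$, and $g(v)_i$ is the optimal number of vertices spanned in a subproblem for the subtree rooted at $v$ with $i$ trees; $x_j^i=1$ means $u$ allocates exactly $i$ units of capacity to child $v_j$. Arithmetic operations on integers are counted as unit cost. -}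

module Defs where

open import Data.Nat using (ℕ; zero; suc; _+_; _*_; _∸_; _≤_; _<_; _≤ᵇ_; _≡ᵇ_)
open import Data.Fin using (Fin; toℕ)
import Data.Fin as Fin
open import Data.Bool using (if_then_else_)
open import Data.List using (List; []; _∷_)
open import Data.Maybe using (Maybe; just; nothing)
open import Data.Product using (Σ; _×_)
open import Relation.Binary.PropositionalEquality using (_≡_)

∑ : (n : ℕ) → (Fin n → ℕ) → ℕ
∑ zero    f = 0
∑ (suc n) f = f Fin.zero + ∑ n (λ i → f (Fin.suc i))

-- NS-MCKP instance: k, d, capacity c, profits g : Fin d → Fin k → ℕ,
-- where g j i stands for g(v_{j+1})_{i+1}.  A candidate solution
-- x j i stands for x_{j+1}^{i+1}.

NonDecreasing : (k d : ℕ) → (Fin d → Fin k → ℕ) → Set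
NonDecreasing k d g = ∀ (j : Fin d) (i i' : Fin k) → toℕ i ≤ toℕ i' → g j i ≤ g j i'

-- weight  Σ_j Σ_i i · x_j^i   (index i is 1-based, hence toℕ i + 1)
weight : (k d : ℕ) → (Fin d → Fin k → ℕ) → ℕ
weight k d x = ∑ d (λ j → ∑ k (λ i → (suc (toℕ i)) * x j i))

objective : (k d : ℕ) → (Fin d → Fin k → ℕ) → (Fin d → Fin k → ℕ) → ℕ
objective k d g x = k + ∑ d (λ j → ∑ k (λ i → g j i * x j i))

Feasible : (k d c : ℕ) → (Fin d → Fin k → ℕ) → Set
Feasible k d c x =
  (∀ (j : Fin d) (i : Fin k) → x j i ≤ 1) ×
  (∀ (j : Fin d) → ∑ k (λ i → x j i) ≤ 1) ×
  weight k d x ≤ c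

IsOptimalValue : (k d c : ℕ) → (Fin d → Fin k → ℕ) → ℕ → Set
IsOptimalValue k d c g v =
  Σ (Fin d → Fin k → ℕ) (λ x → Feasible k d c x × objective k d g x ≡ v) ×
  (∀ (x : Fin d → Fin k → ℕ) → Feasible k d c x → objective k d g x ≤ v)

-- Machine model: a unit-cost RAM over unbounded naturals with
-- indirect addressing.  Every instruction costs one step.

data Instr : Set where
  const : (a n : ℕ) → Instr
  add   : (a b c : ℕ) → Instr
  sub   : (a b c : ℕ) → Instr
  mul   : (a b c : ℕ) → Instr
  load  : (a b : ℕ) → Instr
  store : (a b : ℕ) → Instr
  jle   : (a b t : ℕ) → Instr
  jmp   : (t : ℕ) → Instr

Program : Set
Program = List Instr

Memory : Set
Memory = ℕ → ℕ

record Config : Set where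
  constructor ⟨_,_⟩
  field
    pc  : ℕ
    mem : Memory
open Config public

fetch : Program → ℕ → Maybe Instr
fetch []       _       = nothing
fetch (i ∷ is) zero    = just i
fetch (i ∷ is) (suc n) = fetch is n

update : Memory → ℕ → ℕ → Memory
update m a v x = if x ≡ᵇ a then v else m x

exec : Instr → Config → Config
exec (const a n)   ⟨ p , m ⟩ = ⟨ suc p , update m a n ⟩
exec (add a b c)   ⟨ p , m ⟩ = ⟨ suc p , update m a (m b + m c) ⟩
exec (sub a b c)   ⟨ p , m ⟩ = ⟨ suc p , update m a (m b ∸ m c) ⟩
exec (mul a b c)   ⟨ p , m ⟩ = ⟨ suc p , update m a (m b * m c) ⟩
exec (load a b)    ⟨ p , m ⟩ = ⟨ suc p , update m a (m (m b)) ⟩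
exec (store a b)   ⟨ p , m ⟩ = ⟨ suc p , update m (m a) (m b) ⟩
exec (jle a b t)   ⟨ p , m ⟩ = ⟨ (if m a ≤ᵇ m b then t else suc p) , m ⟩
exec (jmp t)       ⟨ p , m ⟩ = ⟨ t , m ⟩

step : Program → Config → Config
step P cfg with fetch P (pc cfg)
... | nothing = cfg
... | just i  = exec i cfg

run : Program → ℕ → Config → Config
run P zero    cfg = cfg
run P (suc t) cfg = run P t (step P cfg)

Halted : Program → Config → Set
Halted P cfg = fetch P (pc cfg) ≡ nothing

Encodes : (k d c : ℕ) → (Fin d → Fin k → ℕ) → Memory → Set
Encodes k d c g M =
  M 0 ≡ k × M 1 ≡ d × M 2 ≡ c ×
  (∀ (j : Fin d) (i : Fin k) → M (3 + (toℕ j * k + toℕ i)) ≡ g j i) ×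
  (∀ (a : ℕ) → 3 + d * k ≤ a → M a ≡ 0)

-- A table P(w), w ≤ W, holds the best profit of the items not yet processed within
-- capacity w; adding item j gives P'(w) = max(P(w), max_{1 ≤ i ≤ min(k,w)} P(w − i) + g_j(i)).
-- After all d items the answer is k + P(W).  Every feasible solution has weight at
-- most d·k, so W = min(c, d·k) suffices, and the d·(W + 1)·k relaxation steps cost
-- O(k²d²) instructions.  Computing w downwards lets P' overwrite P in place, since
-- P'(w) only reads P at capacities ≤ w.
module Submission where

open import Defs
open import Data.Nat using (ℕ; zero; suc; _+_; _*_; _∸_; _⊓_; _≤_; _<_; _≤ᵇ_; _≡ᵇ_; _<ᵇ_; z≤n; s≤s)
open import Data.Nat.Properties
open import Data.Fin using (Fin; toℕ) renaming (zero to fz; suc to fs)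
open import Data.Fin.Properties using (toℕ<n)
open import Data.Bool using (true; false; if_then_else_; T)
open import Data.Unit using (⊤; tt)
open import Data.Maybe using (just)
open import Data.List using ([]; _∷_)
open import Data.Product using (Σ; _×_; _,_; proj₁; proj₂)
open import Data.Sum using (_⊎_; inj₁; inj₂)
open import Data.Empty using (⊥; ⊥-elim)
open import Relation.Binary.PropositionalEquality
open import Relation.Nullary using (Dec; yes; no)
open import Data.Nat.Tactic.RingSolver
open import Algebra.Properties.CommutativeSemigroup +-commutativeSemigroup using (xy∙z≈xz∙y)

T⇒≡true : ∀ {b} → T b → b ≡ true
T⇒≡true {true} _ = refl

¬T⇒≡false : ∀ {b} → (T b → ⊥) → b ≡ false
¬T⇒≡false {true} f = ⊥-elim (f tt)
¬T⇒≡false {false} f = refl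

if-true : ∀ {A : Set} {b} {x y : A} → b ≡ true → (if b then x else y) ≡ x
if-true refl = refl

if-false : ∀ {A : Set} {b} {x y : A} → b ≡ false → (if b then x else y) ≡ y
if-false refl = refl

≤⇒≤ᵇ≡true : ∀ {a b} → a ≤ b → (a ≤ᵇ b) ≡ true
≤⇒≤ᵇ≡true le = T⇒≡true (≤⇒≤ᵇ le)

>⇒≤ᵇ≡false : ∀ {a b} → b < a → (a ≤ᵇ b) ≡ false
>⇒≤ᵇ≡false {a} {b} lt = ¬T⇒≡false (λ t → <⇒≱ lt (≤ᵇ⇒≤ a b t))

update-same : ∀ (h : ℕ → ℕ) a v → update h a v a ≡ v
update-same h a v = if-true (T⇒≡true (≡⇒≡ᵇ a a refl))

update-other : ∀ (h : ℕ → ℕ) a v x → x ≢ a → update h a v x ≡ h x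
update-other h a v x ne = if-false (¬T⇒≡false (λ q → ne (≡ᵇ⇒≡ x a q)))

update-update : ∀ (h : ℕ → ℕ) a v w x → update (update h a v) a w x ≡ update h a w x
update-update h a v w x with x ≡ᵇ a
... | true = refl
... | false = refl

update-self : ∀ (h : ℕ → ℕ) a x → update h a (h a) x ≡ h x
update-self h a x with x ≟ a
... | yes refl = update-same h x (h x)
... | no ne = update-other h a (h a) x ne

∑-cong : ∀ n {f f' : Fin n → ℕ} → (∀ i → f i ≡ f' i) → ∑ n f ≡ ∑ n f'
∑-cong zero eq = refl
∑-cong (suc n) eq = cong₂ _+_ (eq fz) (∑-cong n (λ i → eq (fs i)))

∑-zero : ∀ n (f : Fin n → ℕ) → (∀ i → f i ≡ 0) → ∑ n f ≡ 0
∑-zero zero f eq = refl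
∑-zero (suc n) f eq rewrite eq fz = ∑-zero n (λ i → f (fs i)) (λ i → eq (fs i))

∑≡0⇒≡0 : ∀ n (f : Fin n → ℕ) → ∑ n f ≡ 0 → ∀ i → f i ≡ 0
∑≡0⇒≡0 (suc n) f eq fz = m+n≡0⇒m≡0 (f fz) eq
∑≡0⇒≡0 (suc n) f eq (fs i) = ∑≡0⇒≡0 n (λ i → f (fs i)) (m+n≡0⇒n≡0 (f fz) eq) i

zeroOne-row-cases : ∀ k (r : Fin k → ℕ) → (∀ i → r i ≤ 1) → ∑ k r ≤ 1 →
                    (∀ (a : Fin k → ℕ) → ∑ k (λ i → a i * r i) ≡ 0) ⊎
                    Σ (Fin k) (λ s → ∀ (a : Fin k → ℕ) → ∑ k (λ i → a i * r i) ≡ a s)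
zeroOne-row-cases zero r r≤1 ∑r≤1 = inj₁ (λ a → refl)
zeroOne-row-cases (suc k) r r≤1 ∑r≤1 with r fz | r≤1 fz
... | 0 | z≤n with zeroOne-row-cases k (λ i → r (fs i)) (λ i → r≤1 (fs i)) ∑r≤1
...   | inj₁ z = inj₁ (λ a → cong₂ _+_ (*-zeroʳ (a fz)) (z (λ i → a (fs i))))
...   | inj₂ (s , z) = inj₂ (fs s , λ a → cong₂ _+_ (*-zeroʳ (a fz)) (z (λ i → a (fs i))))
zeroOne-row-cases (suc k) r r≤1 ∑r≤1 | 1 | s≤s z≤n = inj₂ (fz , λ a →
  trans (cong₂ _+_ (*-identityʳ (a fz)) (∑-zero k _ (λ i → trans (cong (a (fs i) *_) (rest≡0 i)) (*-zeroʳ (a (fs i))))))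
        (+-identityʳ (a fz)))
  where
  rest≡0 : ∀ i → r (fs i) ≡ 0
  rest≡0 = ∑≡0⇒≡0 k (λ i → r (fs i)) (n≤0⇒n≡0 (≤-pred ∑r≤1))

unitRow : ℕ → ∀ {k} → Fin k → ℕ
unitRow m i = if toℕ i ≡ᵇ m then 1 else 0

unitRow≤1 : ∀ m {k} (i : Fin k) → unitRow m i ≤ 1
unitRow≤1 m i with toℕ i ≡ᵇ m
... | true = s≤s z≤n
... | false = z≤n

∑-unitRow : ∀ k (a : ℕ → ℕ) m → m < k → ∑ k (λ i → a (toℕ i) * unitRow m i) ≡ a m
∑-unitRow (suc k) a zero lt =
  trans (cong₂ _+_ (*-identityʳ (a 0)) (∑-zero k _ (λ i → *-zeroʳ (a (suc (toℕ i)))))) (+-identityʳ (a 0))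
∑-unitRow (suc k) a (suc m) (s≤s lt) = cong₂ _+_ (*-zeroʳ (a 0)) (∑-unitRow k (λ x → a (suc x)) m lt)

profit : ∀ k n → (Fin n → Fin k → ℕ) → (Fin n → Fin k → ℕ) → ℕ
profit k n g x = ∑ n (λ j → ∑ k (λ i → g j i * x j i))

-- G j i is the profit of item j at weight i + 1.  The loops below transcribe the
-- machine's inner and middle loops literally, so that optimality is proved once here.
module Recurrence (k : ℕ) (G : ℕ → ℕ → ℕ) where
  candidate : (ℕ → ℕ) → ℕ → ℕ → ℕ → ℕ
  candidate P j w i = P (w ∸ i) + G j (i ∸ 1)

  relax : (ℕ → ℕ) → ℕ → ℕ → ℕ → ℕ → ℕ
  relax P j w acc i = if i ≤ᵇ w then (if candidate P j w i ≤ᵇ acc then acc else candidate P j w i) else acc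

  relaxFrom : (ℕ → ℕ) → ℕ → ℕ → ℕ → ℕ → ℕ → ℕ
  relaxFrom P j w acc i zero = acc
  relaxFrom P j w acc i (suc n) = relaxFrom P j w (relax P j w acc i) (suc i) n

  nextRow : (ℕ → ℕ) → ℕ → ℕ → ℕ
  nextRow P j w = relaxFrom P j w (P w) 1 k

  -- dp n j0 is the table for the n items j0, …, j0 + n − 1.
  dp : ℕ → ℕ → ℕ → ℕ
  dp zero j0 w = 0
  dp (suc n) j0 w = nextRow (dp n (suc j0)) j0 w

  module _ (P : ℕ → ℕ) (j w : ℕ) where
    relax-keep : ∀ acc i → i ≤ w → candidate P j w i ≤ acc → relax P j w acc i ≡ acc
    relax-keep acc i i≤w c≤acc rewrite ≤⇒≤ᵇ≡true i≤w | ≤⇒≤ᵇ≡true c≤acc = refl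

    relax-take : ∀ acc i → i ≤ w → acc < candidate P j w i → relax P j w acc i ≡ candidate P j w i
    relax-take acc i i≤w acc<c rewrite ≤⇒≤ᵇ≡true i≤w | >⇒≤ᵇ≡false acc<c = refl

    relax-skip : ∀ acc i → w < i → relax P j w acc i ≡ acc
    relax-skip acc i w<i rewrite >⇒≤ᵇ≡false w<i = refl

    relax-≥acc : ∀ acc i → acc ≤ relax P j w acc i
    relax-≥acc acc i with i ≤ᵇ w
    ... | false = ≤-refl
    ... | true with candidate P j w i ≤? acc
    ...   | yes le rewrite ≤⇒≤ᵇ≡true le = ≤-refl
    ...   | no nle rewrite >⇒≤ᵇ≡false (≰⇒> nle) = <⇒≤ (≰⇒> nle)

    relax-≥candidate : ∀ acc i → i ≤ w → candidate P j w i ≤ relax P j w acc i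
    relax-≥candidate acc i le rewrite ≤⇒≤ᵇ≡true le with candidate P j w i ≤? acc
    ... | yes ca rewrite ≤⇒≤ᵇ≡true ca = ca
    ... | no nca rewrite >⇒≤ᵇ≡false (≰⇒> nca) = ≤-refl

    relax-cases : ∀ acc i → (relax P j w acc i ≡ acc) ⊎ (i ≤ w × relax P j w acc i ≡ candidate P j w i)
    relax-cases acc i with i ≤? w
    ... | no nle rewrite >⇒≤ᵇ≡false (≰⇒> nle) = inj₁ refl
    ... | yes le rewrite ≤⇒≤ᵇ≡true le with candidate P j w i ≤ᵇ acc
    ...   | true = inj₁ refl
    ...   | false = inj₂ (le , refl)

    relaxFrom-≥acc : ∀ acc i n → acc ≤ relaxFrom P j w acc i n
    relaxFrom-≥acc acc i zero = ≤-refl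
    relaxFrom-≥acc acc i (suc n) = ≤-trans (relax-≥acc acc i) (relaxFrom-≥acc _ (suc i) n)

    relaxFrom-≥candidate : ∀ acc i n i' → i ≤ i' → i' < i + n → i' ≤ w →
                           candidate P j w i' ≤ relaxFrom P j w acc i n
    relaxFrom-≥candidate acc i zero i' i≤i' i'<i+0 _ = ⊥-elim (<⇒≱ i'<i+0 (subst (_≤ i') (sym (+-identityʳ i)) i≤i'))
    relaxFrom-≥candidate acc i (suc n) i' i≤i' i'<i+n i'≤w with i ≟ i'
    ... | yes refl = ≤-trans (relax-≥candidate acc i i'≤w) (relaxFrom-≥acc _ (suc i) n)
    ... | no ne = relaxFrom-≥candidate _ (suc i) n i' (≤∧≢⇒< i≤i' ne) (subst (i' <_) (+-suc i n) i'<i+n) i'≤w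

    relaxFrom-cases : ∀ acc i n → (relaxFrom P j w acc i n ≡ acc) ⊎
                      Σ ℕ (λ i' → i ≤ i' × i' < i + n × i' ≤ w × relaxFrom P j w acc i n ≡ candidate P j w i')
    relaxFrom-cases acc i zero = inj₁ refl
    relaxFrom-cases acc i (suc n) with relaxFrom-cases (relax P j w acc i) (suc i) n
    ... | inj₂ (i' , a , b , c , d) = inj₂ (i' , ≤-trans (n≤1+n i) a , subst (i' <_) (sym (+-suc i n)) b , c , d)
    ... | inj₁ eq with relax-cases acc i
    ...   | inj₁ eq2 = inj₁ (trans eq eq2)
    ...   | inj₂ (le , eq2) = inj₂ (i , ≤-refl , m<m+n i (s≤s z≤n) , le , trans eq eq2)

  OptimalProfit : ∀ n → (Fin n → Fin k → ℕ) → ℕ → ℕ → Set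
  OptimalProfit n h w v = (Σ (Fin n → Fin k → ℕ) λ x → Feasible k n w x × profit k n h x ≡ v) ×
                          (∀ x → Feasible k n w x → profit k n h x ≤ v)

  ProfitsFrom : ℕ → ∀ n → (Fin n → Fin k → ℕ) → Set
  ProfitsFrom j0 n h = ∀ j i → G (j0 + toℕ j) (toℕ i) ≡ h j i

  module Step {n j0} (h : Fin (suc n) → Fin k → ℕ) (profits : ProfitsFrom j0 (suc n) h)
              (IH : ∀ w → OptimalProfit n (λ j → h (fs j)) w (dp n (suc j0) w)) (w : ℕ) where
    P = dp n (suc j0)

    tail : Fin n → Fin k → ℕ
    tail j = h (fs j)

    head-profit : ∀ i → h fz i ≡ G j0 (toℕ i)
    head-profit i = trans (sym (profits fz i)) (cong (λ z → G z (toℕ i)) (+-identityʳ j0))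

    feasible-tail : ∀ {w'} (x : Fin (suc n) → Fin k → ℕ) → (∀ j i → x j i ≤ 1) → (∀ j → ∑ k (x j) ≤ 1) →
                    weight k n (λ j → x (fs j)) ≤ w' → Feasible k n w' (λ j → x (fs j))
    feasible-tail x x≤1 ∑x≤1 wt = (λ j → x≤1 (fs j)) , (λ j → ∑x≤1 (fs j)) , wt

    dp-upper : ∀ x → Feasible k (suc n) w x → profit k (suc n) h x ≤ dp (suc n) j0 w
    dp-upper x (x≤1 , ∑x≤1 , wt) with zeroOne-row-cases k (x fz) (x≤1 fz) (∑x≤1 fz)
    ... | inj₁ z = begin
        ∑ k (λ i → h fz i * x fz i) + profit k n tail x'  ≡⟨ cong (_+ profit k n tail x') (z (h fz)) ⟩
        profit k n tail x'                               ≤⟨ proj₂ (IH w) x' (feasible-tail x x≤1 ∑x≤1 wt') ⟩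
        P w                                              ≤⟨ relaxFrom-≥acc P j0 w (P w) 1 k ⟩
        dp (suc n) j0 w                                  ∎
      where
      open ≤-Reasoning
      x' = λ j → x (fs j)
      wt' : weight k n x' ≤ w
      wt' = subst (λ q → q + weight k n x' ≤ w) (z (λ i → suc (toℕ i))) wt
    ... | inj₂ (s , z) = begin
        ∑ k (λ i → h fz i * x fz i) + profit k n tail x'  ≡⟨ cong (_+ profit k n tail x') (trans (z (h fz)) (head-profit s)) ⟩
        G j0 (toℕ s) + profit k n tail x'                ≤⟨ +-monoʳ-≤ (G j0 (toℕ s)) (proj₂ (IH (w ∸ i)) x' (feasible-tail x x≤1 ∑x≤1 wt')) ⟩
        G j0 (toℕ s) + P (w ∸ i)                         ≡⟨ +-comm (G j0 (toℕ s)) (P (w ∸ i)) ⟩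
        candidate P j0 w i                               ≤⟨ relaxFrom-≥candidate P j0 w (P w) 1 k i (s≤s z≤n) (s≤s (toℕ<n s)) i≤w ⟩
        dp (suc n) j0 w                                  ∎
      where
      open ≤-Reasoning
      x' = λ j → x (fs j)
      i = suc (toℕ s)
      i+wt≤w : i + weight k n x' ≤ w
      i+wt≤w = subst (λ q → q + weight k n x' ≤ w) (z (λ i → suc (toℕ i))) wt
      wt' : weight k n x' ≤ w ∸ i
      wt' = subst (_≤ w ∸ i) (m+n∸m≡n i (weight k n x')) (∸-monoˡ-≤ i i+wt≤w)
      i≤w : i ≤ w
      i≤w = ≤-trans (m≤m+n i _) i+wt≤w

    dp-attained : Σ (Fin (suc n) → Fin k → ℕ) λ x → Feasible k (suc n) w x × profit k (suc n) h x ≡ dp (suc n) j0 w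
    dp-attained with relaxFrom-cases P j0 w (P w) 1 k
    ... | inj₁ eq =
      let (x' , (x'≤1 , ∑x'≤1 , wt) , o) = proj₁ (IH w) in
      (λ { fz → λ _ → 0 ; (fs j) → x' j }) ,
      ((λ { fz i → z≤n ; (fs j) i → x'≤1 j i }) ,
       (λ { fz → ≤-trans (≤-reflexive (∑-zero k (λ _ → 0) (λ _ → refl))) z≤n ; (fs j) → ∑x'≤1 j }) ,
       subst (λ q → q + weight k n x' ≤ w) (sym (∑-zero k _ (λ i → *-zeroʳ (suc (toℕ i))))) wt) ,
      trans (cong₂ _+_ (∑-zero k _ (λ i → *-zeroʳ (h fz i))) o) (sym eq)
    ... | inj₂ (zero , () , _)
    ... | inj₂ (suc m , _ , s≤s m<k , i≤w , eq) =
      let i = suc m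
          (x' , (x'≤1 , ∑x'≤1 , wt) , o) = proj₁ (IH (w ∸ i))
          ∑row≡1 : ∑ k (unitRow m) ≡ 1
          ∑row≡1 = trans (∑-cong k (λ i → sym (*-identityˡ (unitRow m i)))) (∑-unitRow k (λ _ → 1) m m<k)
          row-profit : ∑ k (λ i → h fz i * unitRow m i) ≡ G j0 m
          row-profit = trans (∑-cong k (λ i → cong (_* unitRow m i) (head-profit i))) (∑-unitRow k (G j0) m m<k)
      in
      (λ { fz → unitRow m ; (fs j) → x' j }) ,
      ((λ { fz i → unitRow≤1 m i ; (fs j) i → x'≤1 j i }) ,
       (λ { fz → ≤-reflexive ∑row≡1 ; (fs j) → ∑x'≤1 j }) ,
       subst (_≤ w) (sym (cong (_+ weight k n x') (∑-unitRow k suc m m<k)))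
             (≤-trans (+-monoʳ-≤ i wt) (≤-reflexive (m+[n∸m]≡n i≤w)))) ,
      trans (cong₂ _+_ row-profit o) (trans (+-comm (G j0 m) (P (w ∸ i))) (sym eq))

  dp-optimal : ∀ n j0 (h : Fin n → Fin k → ℕ) → ProfitsFrom j0 n h → ∀ w → OptimalProfit n h w (dp n j0 w)
  dp-optimal zero j0 h profits w = ((λ ()) , ((λ ()) , (λ ()) , z≤n) , refl) , (λ x _ → z≤n)
  dp-optimal (suc n) j0 h profits w = Step.dp-attained h profits IH w , Step.dp-upper h profits IH w
    where
    IH : ∀ w → OptimalProfit n (λ j → h (fs j)) w (dp n (suc j0) w)
    IH = dp-optimal n (suc j0) (λ j → h (fs j))
           (λ j i → trans (cong (λ z → G z (toℕ i)) (sym (+-suc j0 (toℕ j)))) (profits (fs j) i))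

  row-weight≤k : ∀ (r : Fin k → ℕ) → (∀ i → r i ≤ 1) → ∑ k r ≤ 1 → ∑ k (λ i → suc (toℕ i) * r i) ≤ k
  row-weight≤k r r≤1 ∑r≤1 with zeroOne-row-cases k r r≤1 ∑r≤1
  ... | inj₁ z = ≤-trans (≤-reflexive (z (λ i → suc (toℕ i)))) z≤n
  ... | inj₂ (s , z) = ≤-trans (≤-reflexive (z (λ i → suc (toℕ i)))) (toℕ<n s)

  weight≤d*k : ∀ d (x : Fin d → Fin k → ℕ) → (∀ j i → x j i ≤ 1) → (∀ j → ∑ k (x j) ≤ 1) → weight k d x ≤ d * k
  weight≤d*k zero x x≤1 ∑x≤1 = z≤n
  weight≤d*k (suc d) x x≤1 ∑x≤1 =
    +-mono-≤ (row-weight≤k (x fz) (x≤1 fz) (∑x≤1 fz))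
             (weight≤d*k d (λ j → x (fs j)) (λ j → x≤1 (fs j)) (λ j → ∑x≤1 (fs j)))

  dp-solves : ∀ d c (g : Fin d → Fin k → ℕ) → ProfitsFrom 0 d g →
              IsOptimalValue k d c g (k + dp d 0 (c ⊓ (d * k)))
  dp-solves d c g profits =
    (x , (x≤1 , ∑x≤1 , ≤-trans wt (m⊓n≤m c (d * k))) , cong (k +_) o) ,
    λ y (y≤1 , ∑y≤1 , wt′) →
      +-monoʳ-≤ k (proj₂ optimal y (y≤1 , ∑y≤1 , ⊓-glb wt′ (weight≤d*k d y y≤1 ∑y≤1)))
    where
    optimal = dp-optimal d 0 g profits (c ⊓ (d * k))
    x = proj₁ (proj₁ optimal)
    x≤1 = proj₁ (proj₁ (proj₂ (proj₁ optimal)))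
    ∑x≤1 = proj₁ (proj₂ (proj₁ (proj₂ (proj₁ optimal))))
    wt = proj₂ (proj₂ (proj₁ (proj₂ (proj₁ optimal))))
    o = proj₂ (proj₂ (proj₁ optimal))

-- Program proofs split memory into registers (cells below n) and a heap; indirect
-- accesses must target the heap.
merge : ℕ → (ℕ → ℕ) → (ℕ → ℕ) → Memory
merge n R h x = if x <ᵇ n then R x else h x

merge-update-register : ∀ {m n R h a v v'} → m ≗ merge n R h → T (a <ᵇ n) → v ≡ v' →
                        update m a v ≗ merge n (update R a v') h
merge-update-register {m} {n} {R} {h} {a} {v} eq a<n refl x with x ≟ a
... | yes refl = trans (update-same m x v) (sym (trans (if-true (T⇒≡true a<n)) (update-same R x v)))
... | no x≢a = trans (update-other m a v x x≢a) (trans (eq x) (regs-or-heap (x <ᵇ n)))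
  where
  regs-or-heap : ∀ b → (if b then R x else h x) ≡ (if b then update R a v x else h x)
  regs-or-heap true = sym (update-other R a v x x≢a)
  regs-or-heap false = refl

merge-update-heap : ∀ {m n R h a a' v v'} → m ≗ merge n R h → n ≤ a → a' ≡ a → v ≡ v' →
                    update m a' v ≗ merge n R (update h a v')
merge-update-heap {m} {n} {R} {h} {a} {v = v} eq n≤a refl refl x with x ≟ a
... | yes refl = trans (update-same m x v)
                   (sym (trans (if-false (¬T⇒≡false (λ t → <⇒≱ (<ᵇ⇒< x n t) n≤a))) (update-same h x v)))
... | no x≢a = trans (update-other m a v x x≢a) (trans (eq x) (regs-or-heap (x <ᵇ n)))
  where
  regs-or-heap : ∀ b → (if b then R x else h x) ≡ (if b then R x else update h a v x)
  regs-or-heap true = refl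
  regs-or-heap false = sym (update-other h a v x x≢a)

merge-widen : ∀ {m n} → m ≤ n → ∀ R h x → merge m R h x ≡ merge n (merge m R h) h x
merge-widen {m} {n} m≤n R h x with x <ᵇ n in eq
... | true = refl
... | false = if-false (¬T⇒≡false (λ x<m → subst T eq (<⇒<ᵇ (<-≤-trans (<ᵇ⇒< x m x<m) m≤n))))

record Represents (m : Memory) (n : ℕ) (R h : ℕ → ℕ) : Set where
  constructor represents
  field at : m ≗ merge n R h
open Represents public

module ProgramLogic (P : Program) where
  record Reaches (c : Config) (G : Config → Set) (B : ℕ) : Set where
    constructor reaches
    field
      steps : ℕ
      steps≤ : steps ≤ B
      reached : G (run P steps c)

  record Triple (n p : ℕ) (R h : ℕ → ℕ) (G : Config → Set) (B : ℕ) : Set where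
    constructor triple
    field
      execute : ∀ m → Represents m n R h → Reaches ⟨ p , m ⟩ G B
  open Triple public

  Reaches-weaken : ∀ {c G B B'} → Reaches c G B → B ≤ B' → Reaches c G B'
  Reaches-weaken (reaches t t≤B g) B≤B' = reaches t (≤-trans t≤B B≤B') g

  Triple-weaken : ∀ {n p R h G B B'} → Triple n p R h G B → B ≤ B' → Triple n p R h G B'
  Triple-weaken K B≤B' = triple (λ m rep → Reaches-weaken (execute K m rep) B≤B')

  Reaches-step : ∀ {p m c' G B} → step P ⟨ p , m ⟩ ≡ c' → Reaches c' G B → Reaches ⟨ p , m ⟩ G (suc B)
  Reaches-step {G = G} eq (reaches t t≤B g) = reaches (suc t) (s≤s t≤B) (subst (λ c → G (run P t c)) (sym eq) g)

  step-fetched : ∀ c i → fetch P (pc c) ≡ just i → step P c ≡ exec i c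
  step-fetched c i eq with fetch P (pc c)
  step-fetched c i refl | just .i = refl

  read-register : ∀ {m n R h a} → Represents m n R h → T (a <ᵇ n) → m a ≡ R a
  read-register {a = a} (represents eq) a<n = trans (eq a) (if-true (T⇒≡true a<n))

  read-heap : ∀ {m n R h a} → Represents m n R h → n ≤ a → m a ≡ h a
  read-heap {n = n} {a = a} (represents eq) n≤a = trans (eq a) (if-false (¬T⇒≡false (λ t → <⇒≱ (<ᵇ⇒< a n t) n≤a)))

  represents-register : ∀ {m n R h a v v'} → Represents m n R h → T (a <ᵇ n) → v ≡ v' →
                        Represents (update m a v) n (update R a v') h
  represents-register {m} {n} {R} {h} rep a<n eq = represents (merge-update-register {m} {n} {R} {h} (at rep) a<n eq)

  represents-heap : ∀ {m n R h a a' v v'} → Represents m n R h → n ≤ a → a' ≡ a → v ≡ v' →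
                    Represents (update m a' v) n R (update h a v')
  represents-heap {m} {n} {R} {h} rep n≤a eq₁ eq₂ = represents (merge-update-heap {m} {n} {R} {h} (at rep) n≤a eq₁ eq₂)

  Triple-cong : ∀ {n p R R' h G B} → (∀ x → R x ≡ R' x) → Triple n p R h G B → Triple n p R' h G B
  Triple-cong {n} {R = R} {R'} {h} eq K = triple λ m rep → execute K m (represents (λ x → trans (at rep x) (regs-or-heap x (x <ᵇ n))))
    where
    regs-or-heap : ∀ x b → (if b then R' x else h x) ≡ (if b then R x else h x)
    regs-or-heap x true = sym (eq x)
    regs-or-heap x false = refl

  Triple-widen : ∀ {n n' p R h G B} → n ≤ n' → Triple n' p (merge n R h) h G B → Triple n p R h G B
  Triple-widen {R = R} {h} n≤n' K = triple λ m rep → execute K m (represents (λ x → trans (at rep x) (merge-widen n≤n' R h x)))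

  module _ {n p : ℕ} {R h : ℕ → ℕ} {G : Config → Set} {B : ℕ} where
    private
      reg : ∀ {m a} → Represents m n R h → T (a <ᵇ n) → m a ≡ R a
      reg {m} {a} = read-register {m} {n} {R} {h} {a}

      fetched : ∀ {m i} → fetch P p ≡ just i → Reaches (exec i ⟨ p , m ⟩) G B → Reaches ⟨ p , m ⟩ G (suc B)
      fetched {m} f = Reaches-step (step-fetched ⟨ p , m ⟩ _ f)

    const-rule : ∀ {a v} → fetch P p ≡ just (const a v) → T (a <ᵇ n) →
                 Triple n (suc p) (update R a v) h G B → Triple n p R h G (suc B)
    const-rule f ta K = triple (λ m rep → fetched f (execute K _ (represents-register rep ta refl)))

    add-rule : ∀ {a b c} → fetch P p ≡ just (add a b c) → T (a <ᵇ n) → T (b <ᵇ n) → T (c <ᵇ n) →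
               Triple n (suc p) (update R a (R b + R c)) h G B → Triple n p R h G (suc B)
    add-rule f ta tb tc K = triple (λ m rep →
      fetched f (execute K _ (represents-register rep ta (cong₂ _+_ (reg rep tb) (reg rep tc)))))

    sub-rule : ∀ {a b c} → fetch P p ≡ just (sub a b c) → T (a <ᵇ n) → T (b <ᵇ n) → T (c <ᵇ n) →
               Triple n (suc p) (update R a (R b ∸ R c)) h G B → Triple n p R h G (suc B)
    sub-rule f ta tb tc K = triple (λ m rep →
      fetched f (execute K _ (represents-register rep ta (cong₂ _∸_ (reg rep tb) (reg rep tc)))))

    mul-rule : ∀ {a b c} → fetch P p ≡ just (mul a b c) → T (a <ᵇ n) → T (b <ᵇ n) → T (c <ᵇ n) →
               Triple n (suc p) (update R a (R b * R c)) h G B → Triple n p R h G (suc B)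
    mul-rule f ta tb tc K = triple (λ m rep →
      fetched f (execute K _ (represents-register rep ta (cong₂ _*_ (reg rep tb) (reg rep tc)))))

    load-rule : ∀ {a b} → fetch P p ≡ just (load a b) → T (a <ᵇ n) → T (b <ᵇ n) → n ≤ R b →
                Triple n (suc p) (update R a (h (R b))) h G B → Triple n p R h G (suc B)
    load-rule f ta tb n≤Rb K = triple (λ m rep →
      fetched f (execute K _ (represents-register rep ta (trans (cong m (reg rep tb)) (read-heap rep n≤Rb)))))

    store-rule : ∀ {a b} → fetch P p ≡ just (store a b) → T (a <ᵇ n) → T (b <ᵇ n) → n ≤ R a →
                 Triple n (suc p) R (update h (R a) (R b)) G B → Triple n p R h G (suc B)
    store-rule f ta tb n≤Ra K = triple (λ m rep →
      fetched f (execute K _ (represents-heap rep n≤Ra (reg rep ta) (reg rep tb))))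

    jmp-rule : ∀ {t} → fetch P p ≡ just (jmp t) → Triple n t R h G B → Triple n p R h G (suc B)
    jmp-rule f K = triple (λ m rep → fetched f (execute K m rep))

    jle-rule : ∀ {a b t} → fetch P p ≡ just (jle a b t) → T (a <ᵇ n) → T (b <ᵇ n) →
               (R a ≤ R b → Triple n t R h G B) → (R b < R a → Triple n (suc p) R h G B) →
               Triple n p R h G (suc B)
    jle-rule {a} {b} f ta tb K≤ K> = triple λ m rep → branch m rep (R a ≤? R b)
      where
      branch : ∀ m → Represents m n R h → Dec (R a ≤ R b) → Reaches ⟨ p , m ⟩ G (suc B)
      branch m rep (yes le) = fetched f (subst (λ q → Reaches ⟨ q , m ⟩ G B)
        (sym (if-true (≤⇒≤ᵇ≡true (subst₂ _≤_ (sym (reg rep ta)) (sym (reg rep tb)) le)))) (execute (K≤ le) m rep))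
      branch m rep (no nle) = fetched f (subst (λ q → Reaches ⟨ q , m ⟩ G B)
        (sym (if-false (>⇒≤ᵇ≡false (subst₂ _<_ (sym (reg rep tb)) (sym (reg rep ta)) (≰⇒> nle))))) (execute (K> (≰⇒> nle)) m rep))

addTimes : ℕ → ℕ → ℕ → ℕ
addTimes zero k x = x
addTimes (suc n) k x = addTimes n k (x + k)

subTimes : ℕ → ℕ → ℕ → ℕ
subTimes zero k x = x
subTimes (suc n) k x = subTimes n k (x ∸ k)

-- Registers are cells 0–11.  The profits are shifted from cell 3 up to cell 12, k and d·k
-- are saved at A = W + d·k + 12·k (computable by additions alone, and beyond the shifted
-- input), and the table P occupies cells A + 2 + w.
dpProgram : Program
dpProgram =
  -- 0–3: R2 := W = min(c, d·k)
  mul 1 1 0 ∷ jle 2 1 4 ∷ sub 2 2 2 ∷ add 2 2 1 ∷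
  -- 4–23: R2 := A, save k and d·k at A and A + 1
  add 2 2 1 ∷
  add 2 2 0 ∷ add 2 2 0 ∷ add 2 2 0 ∷ add 2 2 0 ∷ add 2 2 0 ∷ add 2 2 0 ∷
  add 2 2 0 ∷ add 2 2 0 ∷ add 2 2 0 ∷ add 2 2 0 ∷ add 2 2 0 ∷ add 2 2 0 ∷
  store 2 0 ∷ const 0 1 ∷ add 0 0 2 ∷ store 0 1 ∷ const 0 11 ∷ add 1 1 0 ∷ sub 2 2 1 ∷
  -- 24–33: M[x] := M[x − 9] for x = 11 + d·k down to 12
  const 0 11 ∷ jle 1 0 34 ∷ const 0 9 ∷ sub 0 1 0 ∷ load 0 0 ∷ store 1 0 ∷ const 0 1 ∷
  sub 1 1 0 ∷ add 2 2 0 ∷ jmp 24 ∷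
  -- 34–56: reload k and d·k; R1 := W, R2 := A + 2, R3 := d·k, R9 := 1, R10 := 0
  add 2 2 1 ∷ load 0 2 ∷ const 1 1 ∷ add 1 1 2 ∷ load 1 1 ∷
  const 9 1 ∷ const 10 0 ∷ add 3 1 10 ∷ sub 1 2 1 ∷
  sub 1 1 0 ∷ sub 1 1 0 ∷ sub 1 1 0 ∷ sub 1 1 0 ∷ sub 1 1 0 ∷ sub 1 1 0 ∷
  sub 1 1 0 ∷ sub 1 1 0 ∷ sub 1 1 0 ∷ sub 1 1 0 ∷ sub 1 1 0 ∷ sub 1 1 0 ∷
  add 2 2 9 ∷ add 2 2 9 ∷
  -- 57–61: items j = d − 1, …, 0 with R3 = j·k, R11 = 11 + j·k
  jle 3 10 84 ∷ sub 3 3 0 ∷ const 11 11 ∷ add 11 11 3 ∷ add 4 1 10 ∷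
  -- 62–64: capacities w = W, …, 0 with R4 = w, R6 := P(w)
  add 7 2 4 ∷ load 6 7 ∷ const 5 1 ∷
  -- 65–78: choices i = 1, …, k with R5 = i, R6 := max(R6, P(w − i) + g_j(i))
  jle 5 0 67 ∷ jmp 79 ∷ jle 5 4 69 ∷ jmp 77 ∷
  sub 7 4 5 ∷ add 7 2 7 ∷ load 7 7 ∷ add 8 11 5 ∷ load 8 8 ∷ add 7 7 8 ∷ jle 7 6 77 ∷ add 6 7 10 ∷
  add 5 5 9 ∷ jmp 65 ∷
  -- 79–83: P(w) := R6
  add 7 2 4 ∷ store 7 6 ∷ jle 4 10 57 ∷ sub 4 4 9 ∷ jmp 62 ∷
  -- 84–86: R0 := k + P(W)
  add 7 2 1 ∷ load 7 7 ∷ add 0 0 7 ∷ []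

open ProgramLogic dpProgram


-- Blocks are verified back to front: each lemma turns a Triple for the code that follows
-- the block into a Triple for the block itself.
module Verification (M : Memory) (1≤k : 1 ≤ M 0) (input≡0 : ∀ a → 3 + M 1 * M 0 ≤ a → M a ≡ 0)
                    (Goal : Config → Set) where
  k = M 0
  d = M 1
  c = M 2
  D = d * k
  profitAt : ℕ → ℕ → ℕ
  profitAt j i = M (3 + (j * k + i))
  open Recurrence k profitAt public
  W = c ⊓ D
  A = addTimes 12 k (W + D)
  tableBase = (A + 1) + 1

  addTimes≡ : ∀ n x → addTimes n k x ≡ x + n * k
  addTimes≡ zero x = sym (+-identityʳ x)
  addTimes≡ (suc n) x = trans (addTimes≡ n (x + k)) (+-assoc x k (n * k))

  subTimes≡ : ∀ n x → subTimes n k x ≡ x ∸ n * k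
  subTimes≡ zero x = refl
  subTimes≡ (suc n) x = trans (subTimes≡ n (x ∸ k)) (∸-+-assoc x k (n * k))

  A≡ : A ≡ W + D + 12 * k
  A≡ = addTimes≡ 12 (W + D)

  12≤12*k : 12 ≤ 12 * k
  12≤12*k = ≤-trans (≤-reflexive (sym (*-identityʳ 12))) (*-monoʳ-≤ 12 1≤k)

  12+D≤A : 12 + D ≤ A
  12+D≤A = subst (12 + D ≤_) (sym A≡)
       (≤-trans (≤-reflexive (+-comm 12 D)) (+-mono-≤ (m≤n+m D W) 12≤12*k))

  12+D≤base : 12 + D ≤ tableBase
  12+D≤base = ≤-trans 12+D≤A (≤-trans (m≤m+n A 1) (m≤m+n (A + 1) 1))

  12≤base : 12 ≤ tableBase
  12≤base = ≤-trans (m≤m+n 12 D) 12+D≤base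

  FixedRegisters : (ℕ → ℕ) → Set
  FixedRegisters R = R 0 ≡ k × R 1 ≡ W × R 2 ≡ tableBase × R 9 ≡ 1 × R 10 ≡ 0

  module _ (R : ℕ → ℕ) (fx : FixedRegisters R) where
    R0≡k : R 0 ≡ k
    R0≡k = proj₁ fx
    R1≡W : R 1 ≡ W
    R1≡W = proj₁ (proj₂ fx)
    R2≡base : R 2 ≡ tableBase
    R2≡base = proj₁ (proj₂ (proj₂ fx))
    R9≡1 : R 9 ≡ 1
    R9≡1 = proj₁ (proj₂ (proj₂ (proj₂ fx)))
    R10≡0 : R 10 ≡ 0
    R10≡0 = proj₂ (proj₂ (proj₂ (proj₂ fx)))

  ProfitsShifted : (ℕ → ℕ) → Set
  ProfitsShifted h = ∀ j i → j < d → i < k → h (12 + (j * k + i)) ≡ profitAt j i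

  module ChoiceLoop (j w : ℕ) (Pold : ℕ → ℕ) (h : ℕ → ℕ) (j<d : j < d) (shifted : ProfitsShifted h)
               (old : ∀ x → x ≤ w → h (tableBase + x) ≡ Pold x) where

    choiceLoop : ∀ n i acc R B → FixedRegisters R → R 3 ≡ j * k → R 4 ≡ w → R 11 ≡ 11 + j * k →
             R 5 ≡ i → R 6 ≡ acc → i + n ≡ suc k → 1 ≤ i →
             (∀ R' → FixedRegisters R' → R' 3 ≡ j * k → R' 4 ≡ w → R' 11 ≡ 11 + j * k →
                R' 6 ≡ relaxFrom Pold j w acc i n → Triple 12 79 R' h Goal B) →
             Triple 12 65 R h Goal (n * 12 + 2 + B)
    choiceLoop zero i acc R B fx e3 e4 e11 e5 e6 ein i1 K =
      jle-rule refl tt tt (λ le → ⊥-elim (<-irrefl refl (subst₂ _≤_ (trans e5 (trans (sym (+-identityʳ i)) ein)) (R0≡k R fx) le)))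
        (λ _ → jmp-rule refl (K R fx e3 e4 e11 e6))
    choiceLoop (suc n) zero acc R B fx e3 e4 e11 e5 e6 ein ()
    choiceLoop (suc n) (suc i) acc R B fx e3 e4 e11 e5 e6 ein i1 K =
      jle-rule refl tt tt (λ _ → body) (λ lt → ⊥-elim (<⇒≱ (subst₂ _<_ (R0≡k R fx) e5 lt) i<k))
      where
      ein' : suc (suc i) + n ≡ suc k
      ein' = trans (sym (+-suc (suc i) n)) ein
      i<k : suc i ≤ k
      i<k = ≤-pred (subst (suc (suc i) ≤_) ein' (m≤m+n (suc (suc i)) n))
      e10 = R10≡0 R fx
      e2 = R2≡base R fx
      IH = choiceLoop n (suc (suc i)) (relax Pold j w acc (suc i))
      next : ∀ R' → FixedRegisters R' → R' 3 ≡ j * k → R' 4 ≡ w → R' 11 ≡ 11 + j * k → R' 5 ≡ suc i →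
             R' 6 ≡ relax Pold j w acc (suc i) → Triple 12 77 R' h Goal (2 + (n * 12 + 2 + B))
      next R' fx' e3' e4' e11' e5' e6' =
        add-rule refl tt tt tt (jmp-rule refl (IH _ B fx' e3' e4' e11'
           (trans (cong₂ _+_ e5' (R9≡1 R' fx')) (+-comm (suc i) 1)) e6' ein' (s≤s z≤n)
           K))
      addr-eq : (11 + j * k) + suc i ≡ 12 + (j * k + i)
      addr-eq = trans (+-suc (11 + j * k) i) (cong suc (+-assoc 11 (j * k) i))
      candEq : h (R 2 + (R 4 ∸ R 5)) + h (R 11 + R 5) ≡ candidate Pold j w (suc i)
      candEq = cong₂ _+_ (trans (cong h (cong₂ _+_ e2 (cong₂ _∸_ e4 e5))) (old (w ∸ suc i) (m∸n≤m w (suc i))))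
                         (trans (cong h (trans (cong₂ _+_ e11 e5) addr-eq)) (shifted j i j<d i<k))
      addr≥12 : 12 ≤ R 2 + (R 4 ∸ R 5)
      addr≥12 = ≤-trans 12≤base (≤-trans (≤-reflexive (sym e2)) (m≤m+n (R 2) _))
      addr'≥12 : 12 ≤ R 11 + R 5
      addr'≥12 = subst (12 ≤_) (sym (trans (cong₂ _+_ e11 e5) addr-eq)) (m≤m+n 12 _)
      body = jle-rule refl tt tt candP skipP
        where
        skipP = λ lt → jmp-rule refl (Triple-weaken
          (next R fx e3 e4 e11 e5 (trans e6 (sym (relax-skip Pold j w acc (suc i) (subst₂ _<_ e4 e5 lt)))))
          (m≤n+m _ 7))
        candP = λ iw →
          let i≤w = subst₂ _≤_ e5 e4 iw in
          sub-rule refl tt tt tt (add-rule refl tt tt tt (load-rule refl tt tt addr≥12 (add-rule refl tt tt tt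
            (load-rule refl tt tt addr'≥12 (add-rule refl tt tt tt (jle-rule refl tt tt
              (λ c≤acc → Triple-weaken (next _ fx e3 e4 e11 e5
                 (trans e6 (sym (relax-keep Pold j w acc (suc i) i≤w (subst₂ _≤_ candEq e6 c≤acc)))))
                 (m≤n+m _ 1))
              (λ acc<c → add-rule refl tt tt tt (next _ fx e3 e4 e11 e5
                 (trans (trans (cong₂ _+_ candEq e10) (+-identityʳ _))
                        (sym (relax-take Pold j w acc (suc i) i≤w (subst₂ _<_ e6 candEq acc<c))))))))))))

  profitIndex<D : ∀ j i → j < d → i < k → j * k + i < D
  profitIndex<D j i j<d i<k = ≤-trans (≤-reflexive (sym (+-suc (j * k) i)))
                   (≤-trans (+-monoʳ-≤ (j * k) i<k) (≤-trans (≤-reflexive (+-comm (j * k) k)) (*-monoˡ-≤ k j<d)))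

  profitCell≢tableCell : ∀ j i w → j < d → i < k → 12 + (j * k + i) ≢ tableBase + w
  profitCell≢tableCell j i w j<d i<k eq =
    <⇒≱ (+-monoʳ-< 12 (profitIndex<D j i j<d i<k)) (≤-trans 12+D≤base (≤-trans (m≤m+n tableBase w) (≤-reflexive (sym eq))))

  module _ (h : ℕ → ℕ) {a v : ℕ} (w : ℕ) (a≡ : a ≡ tableBase + w) where
    tableWrite-same : update h a v (tableBase + w) ≡ v
    tableWrite-same rewrite a≡ = update-same h (tableBase + w) v

    tableWrite-other : ∀ x → x ≢ w → update h a v (tableBase + x) ≡ h (tableBase + x)
    tableWrite-other x x≢w rewrite a≡ = update-other h (tableBase + w) v (tableBase + x) (λ eq → x≢w (+-cancelˡ-≡ tableBase x w eq))

    ProfitsShifted-tableWrite : ProfitsShifted h → ProfitsShifted (update h a v)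
    ProfitsShifted-tableWrite shifted j i j<d i<k rewrite a≡ =
      trans (update-other h (tableBase + w) v _ (profitCell≢tableCell j i w j<d i<k)) (shifted j i j<d i<k)

  costPerCapacity : ℕ
  costPerCapacity = k * 12 + 10

  capacityCost-step : ∀ k w B → 3 + (k * 12 + 2 + (5 + (suc w * (k * 12 + 10) + B))) ≡ suc (suc w) * (k * 12 + 10) + B
  capacityCost-step = solve-∀

  capacityCost-last : ∀ k B → 3 + (k * 12 + 2 + (3 + B)) + 2 ≡ 1 * (k * 12 + 10) + B
  capacityCost-last = solve-∀

  module CapacityLoop (j : ℕ) (j<d : j < d) (Pold : ℕ → ℕ) where
    nextRow′ = nextRow Pold j

    capacityLoop : ∀ w R h B → FixedRegisters R → R 3 ≡ j * k → R 11 ≡ 11 + j * k → R 4 ≡ w → ProfitsShifted h →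
      (∀ x → x ≤ w → h (tableBase + x) ≡ Pold x) → (∀ x → w < x → x ≤ W → h (tableBase + x) ≡ nextRow′ x) →
      (∀ R' h' → FixedRegisters R' → R' 3 ≡ j * k → ProfitsShifted h' →
         (∀ x → x ≤ W → h' (tableBase + x) ≡ nextRow′ x) → Triple 12 57 R' h' Goal B) →
      Triple 12 62 R h Goal (suc w * costPerCapacity + B)
    capacityLoop w R h B fx e3 e11 e4 shifted old new K = Triple-weaken {B = 3 + (k * 12 + 2 + costFromStore w)} (start w refl) (cost≤ w)
      where
      e2 = R2≡base R fx
      e10 = R10≡0 R fx
      costFromTest : ℕ → ℕ
      costFromTest zero = B
      costFromTest (suc w') = 2 + (suc w' * costPerCapacity + B)
      costFromStore : ℕ → ℕ
      costFromStore w = 3 + costFromTest w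
      cost≤ : ∀ w → 3 + (k * 12 + 2 + costFromStore w) ≤ suc w * costPerCapacity + B
      cost≤ zero = ≤-trans (m≤m+n _ 2) (≤-reflexive (capacityCost-last k B))
      cost≤ (suc w') = ≤-reflexive (capacityCost-step k w' B)
      addr : R 2 + R 4 ≡ tableBase + w
      addr = cong₂ _+_ e2 e4
      addr≥12 : 12 ≤ R 2 + R 4
      addr≥12 = subst (12 ≤_) (sym addr) (≤-trans 12≤base (m≤m+n tableBase w))
      storeEntry : ∀ w' → w' ≡ w → ∀ R' → FixedRegisters R' → R' 3 ≡ j * k → R' 4 ≡ w' → R' 11 ≡ 11 + j * k →
                R' 6 ≡ nextRow′ w' → Triple 12 79 R' h Goal (costFromStore w')
      storeEntry w' refl R' fx' e3' e4' e11' e6' =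
        add-rule refl tt tt tt (store-rule refl tt tt addr≥12' (jle-rule refl tt tt (λ le → lastCapacity w refl le) (λ lt → nextCapacity w refl lt)))
        where
        e2' = R2≡base R' fx'
        addr' : R' 2 + R' 4 ≡ tableBase + w
        addr' = cong₂ _+_ e2' e4'
        addr≥12' : 12 ≤ R' 2 + R' 4
        addr≥12' = subst (12 ≤_) (sym addr') (≤-trans 12≤base (m≤m+n tableBase w))
        h' = update h (R' 2 + R' 4) (R' 6)
        R'' = update R' 7 (R' 2 + R' 4)
        h'new : h' (tableBase + w) ≡ nextRow′ w
        h'new = trans (tableWrite-same h w addr') e6'
        h'oth : ∀ x → x ≢ w → h' (tableBase + x) ≡ h (tableBase + x)
        h'oth = tableWrite-other h w addr'
        shifted' : ProfitsShifted h'
        shifted' = ProfitsShifted-tableWrite h w addr' shifted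
        lastCapacity : ∀ w'' → w'' ≡ w → R' 4 ≤ R' 10 → Triple 12 57 R'' h' Goal (costFromTest w'')
        lastCapacity zero refl le = K R'' h' fx' e3' shifted' tab
          where
          tab : ∀ x → x ≤ W → h' (tableBase + x) ≡ nextRow′ x
          tab zero _ = h'new
          tab (suc x) xW = trans (h'oth (suc x) (λ ())) (new (suc x) (s≤s z≤n) xW)
        lastCapacity (suc w'') eq le = ⊥-elim (<⇒≱ (s≤s z≤n) (subst₂ _≤_ (trans e4' (sym eq)) (R10≡0 R' fx') le))
        nextCapacity : ∀ w'' → w'' ≡ w → R' 10 < R' 4 → Triple 12 82 R'' h' Goal (costFromTest w'')
        nextCapacity zero refl lt = ⊥-elim (<⇒≱ (subst₂ _<_ (R10≡0 R' fx') e4' lt) z≤n)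
        nextCapacity (suc w'') refl lt =
          sub-rule refl tt tt tt (jmp-rule refl (capacityLoop w'' _ h' B fx' e3' e11' (trans (cong₂ _∸_ e4' (R9≡1 R' fx')) refl)
             shifted' old' new' K))
          where
          old' : ∀ x → x ≤ w'' → h' (tableBase + x) ≡ Pold x
          old' x le = trans (h'oth x (λ q → <-irrefl refl (subst (_≤ w'') q le))) (old x (≤-trans le (n≤1+n w'')))
          new' : ∀ x → w'' < x → x ≤ W → h' (tableBase + x) ≡ nextRow′ x
          new' x lt xW with x ≟ suc w''
          ... | yes refl = h'new
          ... | no ne = trans (h'oth x ne) (new x (≤∧≢⇒< lt (λ q → ne (sym q))) xW)
      start : ∀ w' → w' ≡ w → Triple 12 62 R h Goal (3 + (k * 12 + 2 + costFromStore w'))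
      start w' refl = add-rule refl tt tt tt (load-rule refl tt tt addr≥12 (const-rule refl tt
        (ChoiceLoop.choiceLoop j w Pold h j<d shifted old k 1 (Pold w) _ (costFromStore w) fx e3 e4 e11 refl
          (trans (cong h addr) (old w ≤-refl)) refl (s≤s z≤n)
          (λ R' fx' e3' e4' e11' e6' → storeEntry w refl R' fx' e3' e4' e11' e6'))))

  costPerItem : ℕ
  costPerItem = 5 + suc W * costPerCapacity

  itemCost-step : ∀ x y B → x + (y + 1 + B) ≡ x + y + 1 + B
  itemCost-step = solve-∀

  itemLoop : ∀ n' m' R h B → m' + n' ≡ d → FixedRegisters R → R 3 ≡ n' * k → ProfitsShifted h →
    (∀ x → x ≤ W → h (tableBase + x) ≡ dp m' n' x) →
    (∀ R' h' → FixedRegisters R' → ProfitsShifted h' → (∀ x → x ≤ W → h' (tableBase + x) ≡ dp d 0 x) → Triple 12 84 R' h' Goal B) →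
    Triple 12 57 R h Goal (n' * costPerItem + 1 + B)
  itemLoop zero m' R h B m'+n'≡d fx e3 shifted tab K =
    jle-rule refl tt tt (λ _ → K R h fx shifted (λ x xW → trans (tab x xW) (cong (λ q → dp q 0 x) (trans (sym (+-identityʳ m')) m'+n'≡d))))
      (λ lt → ⊥-elim (<⇒≱ (subst₂ _<_ (R10≡0 R fx) e3 lt) z≤n))
  itemLoop (suc n) m' R h B m'+n'≡d fx e3 shifted tab K =
    jle-rule refl tt tt (λ le → ⊥-elim (<⇒≱ (≤-trans 1≤k (m≤m+n k (n * k))) (subst₂ _≤_ e3 (R10≡0 R fx) le)))
      (λ _ → Triple-weaken {B = 4 + (suc W * costPerCapacity + (n * costPerItem + 1 + B))} (sub-rule refl tt tt tt (const-rule refl tt (add-rule refl tt tt tt (add-rule refl tt tt tt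
        (CapacityLoop.capacityLoop n j<d (dp m' (suc n)) W _ h (n * costPerItem + 1 + B) fx e3' (cong (11 +_) e3') e4 shifted tab
          (λ x lt xW → ⊥-elim (<⇒≱ lt xW))
          (λ R' h' fx' e3'' shifted' tab' → itemLoop n (suc m') R' h' B (trans (sym (+-suc m' n)) m'+n'≡d) fx' e3'' shifted' tab' K))))))
        (≤-reflexive (cong (4 +_) (itemCost-step (suc W * costPerCapacity) (n * costPerItem) B))))
    where
    j<d : n < d
    j<d = subst (n <_) m'+n'≡d (≤-trans (s≤s (m≤n+m n m')) (≤-reflexive (sym (+-suc m' n))))
    e3' : R 3 ∸ R 0 ≡ n * k
    e3' = trans (cong₂ _∸_ e3 (R0≡k R fx)) (m+n∸m≡n k (n * k))
    e4 : R 1 + R 10 ≡ W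
    e4 = trans (cong₂ _+_ (R1≡W R fx) (R10≡0 R fx)) (+-identityʳ W)

  finish : (∀ m → m 0 ≡ k + dp d 0 W → Goal ⟨ 87 , m ⟩) →
         ∀ R h → FixedRegisters R → (∀ x → x ≤ W → h (tableBase + x) ≡ dp d 0 x) → Triple 12 84 R h Goal 3
  finish halt R h fx tab = add-rule refl tt tt tt (load-rule refl tt tt resultAddr≥12 (add-rule refl tt tt tt
      (triple λ m e → reaches 0 z≤n (halt m (trans (read-register e tt) (cong₂ _+_ (R0≡k R fx)
         (trans (cong h (cong₂ _+_ (R2≡base R fx) (R1≡W R fx))) (tab W ≤-refl))))))))
    where
    resultAddr≥12 : 12 ≤ R 2 + R 1
    resultAddr≥12 = subst (12 ≤_) (sym (cong₂ _+_ (R2≡base R fx) (R1≡W R fx))) (≤-trans 12≤base (m≤m+n tableBase W))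

  CopyInvariant : ℕ → (ℕ → ℕ) → Set
  CopyInvariant u h = (∀ x → u < x → x < 12 + D → h x ≡ M (x ∸ 9)) ×
             (∀ x → 3 ≤ x → x ≤ u → h x ≡ M x) ×
             h A ≡ k × h (1 + A) ≡ D × (∀ x → 2 + A ≤ x → h x ≡ 0)

  copyLoop : ∀ q R h B → q ≤ D → R 1 ≡ 11 + q → R 2 + R 1 ≡ A → CopyInvariant (11 + q) h →
          (∀ R' h' → R' 2 + R' 1 ≡ A → CopyInvariant 11 h' → Triple 3 34 R' h' Goal B) →
          Triple 3 24 R h Goal (q * 10 + 2 + B)
  copyLoop zero R h B qD e1 eA inv Kc =
    const-rule refl tt (jle-rule refl tt tt (λ _ → Kc _ h eA inv)
      (λ lt → ⊥-elim (<-irrefl refl (subst (11 <_) e1 lt))))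
  copyLoop (suc q) R h B qD e1 eA (c1 , c2 , c3 , c4 , c5) Kc =
    const-rule refl tt (jle-rule refl tt tt
      (λ le → ⊥-elim (<⇒≱ (s≤s (m≤m+n 11 q)) (subst (_≤ 11) e1 le)))
      (λ _ → const-rule refl tt (sub-rule refl tt tt tt (load-rule refl tt tt src≥3 (store-rule refl tt tt dst≥3
        (const-rule refl tt (sub-rule refl tt tt tt (add-rule refl tt tt tt (jmp-rule refl
          (copyLoop q _ h' B (≤-trans (n≤1+n q) qD) (cong (_∸ 1) e1) eA' inv' Kc))))))))))
    where
    u = 12 + q
    src≥3 : 3 ≤ R 1 ∸ 9
    src≥3 = subst (3 ≤_) (sym (cong (_∸ 9) e1)) (m≤m+n 3 q)
    dst≥3 : 3 ≤ R 1
    dst≥3 = subst (3 ≤_) (sym e1) (m≤m+n 3 (9 + q))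
    v = h (R 1 ∸ 9)
    h' = update h (R 1) v
    veq : v ≡ M (3 + q)
    veq = trans (cong (λ z → h (z ∸ 9)) e1) (c2 (3 + q) (m≤m+n 3 q) (+-monoˡ-≤ q (s≤s (s≤s (s≤s z≤n)))))
    uA : u < A
    uA = ≤-trans (s≤s (≤-trans (≤-reflexive (+-suc 11 q)) (+-monoʳ-≤ 11 qD))) 12+D≤A
    oth : ∀ x → x ≢ u → h' x ≡ h x
    oth x ne = trans (cong (λ z → update h z v x) e1) (update-other h u v x ne)
    same : h' u ≡ M (3 + q)
    same = trans (cong (λ z → update h z v u) e1) (trans (update-same h u v) veq)
    eA' : (R 2 + 1) + (R 1 ∸ 1) ≡ A
    eA' = trans (cong (λ z → (R 2 + 1) + (z ∸ 1)) e1) (trans (+-assoc (R 2) 1 (11 + q)) (trans (cong (R 2 +_) (sym e1)) eA))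
    inv' : CopyInvariant (11 + q) h'
    inv' = i1 , i2 , trans (oth A (λ q → <-irrefl (sym q) uA)) c3 ,
                     trans (oth (1 + A) (λ q → <-irrefl (sym q) (≤-trans uA (n≤1+n A)))) c4 ,
                     (λ x le → trans (oth x (λ q → <-irrefl (sym q) (≤-trans uA (≤-trans (≤-trans (n≤1+n A) (n≤1+n (1 + A))) le)))) (c5 x le))
      where
      i1 : ∀ x → 11 + q < x → x < 12 + D → h' x ≡ M (x ∸ 9)
      i1 x lt lD with x ≟ u
      ... | yes refl = same
      ... | no ne = trans (oth x ne) (c1 x (≤∧≢⇒< lt (λ eq → ne (sym eq))) lD)
      i2 : ∀ x → 3 ≤ x → x ≤ 11 + q → h' x ≡ M x
      i2 x l3 le = trans (oth x (λ eq → <-irrefl refl (subst (_≤ 11 + q) eq le))) (c2 x l3 (≤-trans le (n≤1+n (11 + q))))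

  W-recovered : subTimes 12 k (A ∸ D) ≡ W
  W-recovered = begin
    subTimes 12 k (A ∸ D)          ≡⟨ subTimes≡ 12 (A ∸ D) ⟩
    A ∸ D ∸ 12 * k                 ≡⟨ cong (λ z → z ∸ D ∸ 12 * k) (trans A≡ (xy∙z≈xz∙y W D (12 * k))) ⟩
    W + 12 * k + D ∸ D ∸ 12 * k    ≡⟨ cong (_∸ 12 * k) (m+n∸n≡m (W + 12 * k) D) ⟩
    W + 12 * k ∸ 12 * k            ≡⟨ m+n∸n≡m W (12 * k) ⟩
    W                              ∎
    where open ≡-Reasoning

  2+A≤base : 2 + A ≤ tableBase
  2+A≤base = ≤-reflexive (sym (trans (+-assoc A 1 1) (+-comm A 2)))

  Repeated : ℕ → ℕ → Instr → Set
  Repeated zero p i = ⊤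
  Repeated (suc n) p i = fetch dpProgram p ≡ just i × Repeated n (suc p) i

  subRepeated : ∀ n p R h B → Repeated n p (sub 1 1 0) →
           Triple 12 (n + p) (update R 1 (subTimes n (R 0) (R 1))) h Goal B → Triple 12 p R h Goal (n + B)
  subRepeated zero p R h B _ K = Triple-cong (update-self R 1) K
  subRepeated (suc n) p R h B (f , fr) K = sub-rule f tt tt tt (subRepeated n (suc p) _ h B fr
     (Triple-cong (λ x → sym (update-update R 1 (R 1 ∸ R 0) _ x)) (subst (λ q → Triple 12 q (update R 1 (subTimes (suc n) (R 0) (R 1))) h Goal B) (sym (+-suc n p)) K)))

  addRepeated : ∀ n p R h B → Repeated n p (add 2 2 0) →
           Triple 3 (n + p) (update R 2 (addTimes n (R 0) (R 2))) h Goal B → Triple 3 p R h Goal (n + B)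
  addRepeated zero p R h B _ K = Triple-cong (update-self R 2) K
  addRepeated (suc n) p R h B (f , fr) K = add-rule f tt tt tt (addRepeated n (suc p) _ h B fr
     (Triple-cong (λ x → sym (update-update R 2 (R 2 + R 0) _ x)) (subst (λ q → Triple 3 q (update R 2 (addTimes (suc n) (R 0) (R 2))) h Goal B) (sym (+-suc n p)) K)))

  dpInitBlock : ∀ R h B → R 0 ≡ k → R 1 ≡ D → R 2 ≡ A → CopyInvariant 11 h →
         (∀ R' h' → FixedRegisters R' → ProfitsShifted h' → (∀ x → x ≤ W → h' (tableBase + x) ≡ dp d 0 x) → Triple 12 84 R' h' Goal B) →
         Triple 12 39 R h Goal (18 + (d * costPerItem + 1 + B))
  dpInitBlock R h B e0 e1 e2 (c1 , c2 , c3 , c4 , c5) Kend =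
    const-rule refl tt (const-rule refl tt (add-rule refl tt tt tt (sub-rule refl tt tt tt
    (subRepeated 12 43 _ h _ (refl , refl , refl , refl , refl , refl , refl , refl , refl , refl , refl , refl , _)
    (add-rule refl tt tt tt (add-rule refl tt tt tt
      (itemLoop d 0 _ h B refl fx (trans (+-identityʳ (R 1)) e1) shifted tab Kend)))))))
    where
    fx : FixedRegisters (update (update (update (update (update (update R 9 1) 10 0) 3 (R 1 + 0)) 1 (R 2 ∸ R 1)) 1 (subTimes 12 (R 0) (R 2 ∸ R 1))) 2 ((R 2 + 1) + 1))
    fx = e0 , trans (cong₂ (λ a b → subTimes 12 a b) e0 (cong₂ _∸_ e2 e1)) W-recovered , cong (λ z → (z + 1) + 1) e2 , refl , refl
    shifted : ProfitsShifted h
    shifted j i j<d i<k = c1 (12 + (j * k + i)) (m≤m+n 12 _) (+-monoʳ-< 12 (profitIndex<D j i j<d i<k))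
    tab : ∀ x → x ≤ W → h (tableBase + x) ≡ 0
    tab x _ = c5 (tableBase + x) (≤-trans 2+A≤base (m≤m+n tableBase x))

  3≤A : 3 ≤ A
  3≤A = ≤-trans (s≤s (s≤s (s≤s z≤n))) (≤-trans (m≤m+n 12 D) 12+D≤A)

  -- Until pc 39 only cells 0–2 are registers, since the copy loop reads the input from cell 3 on.
  reloadBlock : ∀ R h B → R 2 + R 1 ≡ A → CopyInvariant 11 h →
         (∀ R' h' → FixedRegisters R' → ProfitsShifted h' → (∀ x → x ≤ W → h' (tableBase + x) ≡ dp d 0 x) → Triple 12 84 R' h' Goal B) →
         Triple 3 34 R h Goal (5 + (18 + (d * costPerItem + 1 + B)))
  reloadBlock R h B eA inv Kend =
    add-rule refl tt tt tt (load-rule refl tt tt (subst (3 ≤_) (sym eA) 3≤A) (const-rule refl tt (add-rule refl tt tt tt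
      (load-rule refl tt tt (subst (3 ≤_) (sym (cong (1 +_) eA)) (≤-trans 3≤A (n≤1+n A)))
        (Triple-widen (s≤s (s≤s (s≤s z≤n))) (dpInitBlock _ h B (trans (cong h eA) (proj₁ (proj₂ (proj₂ inv))))
                          (trans (cong (λ z → h (1 + z)) eA) (proj₁ (proj₂ (proj₂ (proj₂ inv))))) eA inv Kend))))))

  inputWithSaved : ℕ → ℕ
  inputWithSaved = update (update M A k) (1 + A) D

  inputWithSaved-invariant : CopyInvariant (11 + D) inputWithSaved
  inputWithSaved-invariant = (λ x lt lD → ⊥-elim (<-irrefl refl (≤-trans lt (≤-pred lD)))) ,
          (λ x _ le → small x (≤-trans (s≤s le) 12+D≤A)) ,
          trans (update-other (update M A k) (1 + A) D A (λ eq → <-irrefl eq (n<1+n A))) (update-same M A k) ,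
          update-same (update M A k) (1 + A) D ,
          (λ x le → trans (update-other (update M A k) (1 + A) D x (λ q → <-irrefl refl (subst (2 + A ≤_) q le)))
                    (trans (update-other M A k x (λ q → <-irrefl refl (≤-trans (n≤1+n (suc A)) (subst (2 + A ≤_) q le))))
                      (input≡0 x (≤-trans (+-monoˡ-≤ D (s≤s (s≤s (s≤s (z≤n {9})))) ) (≤-trans 12+D≤A (≤-trans (≤-trans (n≤1+n A) (n≤1+n (1 + A))) le))))))
    where
    small : ∀ x → x < A → inputWithSaved x ≡ M x
    small x lt = trans (update-other (update M A k) (1 + A) D x (λ q → <-irrefl refl (≤-trans (≤-reflexive (cong suc (sym q))) (≤-trans lt (n≤1+n A)))))
                   (update-other M A k x (λ q → <-irrefl q lt))

  CopyInvariant-cong : ∀ {u h h'} → (∀ x → h x ≡ h' x) → CopyInvariant u h' → CopyInvariant u h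
  CopyInvariant-cong eq (c1 , c2 , c3 , c4 , c5) =
    (λ x a b → trans (eq x) (c1 x a b)) , (λ x a b → trans (eq x) (c2 x a b)) ,
    trans (eq _) c3 , trans (eq _) c4 , (λ x a → trans (eq x) (c5 x a))

  setupBlock : ∀ R B → R 0 ≡ k → R 1 ≡ D → R 2 ≡ W →
         (∀ R' h' → R' 2 + R' 1 ≡ A → CopyInvariant 11 h' → Triple 3 34 R' h' Goal B) →
         Triple 3 4 R M Goal (20 + (D * 10 + 2 + B))
  setupBlock R B e0 e1 e2 Kc =
    add-rule refl tt tt tt (addRepeated 12 5 _ M _ (refl , refl , refl , refl , refl , refl , refl , refl , refl , refl , refl , refl , _)
      (store-rule refl tt tt (subst (3 ≤_) (sym AvEq) 3≤A) (const-rule refl tt (add-rule refl tt tt tt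
        (store-rule refl tt tt (subst (3 ≤_) (sym (cong (1 +_) AvEq)) (≤-trans 3≤A (n≤1+n A)))
          (const-rule refl tt (add-rule refl tt tt tt (sub-rule refl tt tt tt
            (copyLoop D _ _ B ≤-refl (trans (cong (_+ 11) e1) (+-comm D 11)) eA' (CopyInvariant-cong h2eq inputWithSaved-invariant) Kc)))))))))
    where
    Av = addTimes 12 (R 0) (R 2 + R 1)
    AvEq : Av ≡ A
    AvEq = cong₂ (addTimes 12) e0 (cong₂ _+_ e2 e1)
    h2eq : ∀ x → update (update M Av (R 0)) (1 + Av) (R 1) x ≡ inputWithSaved x
    h2eq x = trans (cong (λ z → update (update M z (R 0)) (1 + z) (R 1) x) AvEq)
                   (cong₂ (λ a b → update (update M A a) (1 + A) b x) e0 e1)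
    le : R 1 + 11 ≤ Av
    le = subst₂ _≤_ (sym (trans (cong (_+ 11) e1) (+-comm D 11))) (sym AvEq) (≤-trans (n≤1+n (11 + D)) 12+D≤A)
    eA' : (Av ∸ (R 1 + 11)) + (R 1 + 11) ≡ A
    eA' = trans (m∸n+n≡m le) AvEq

  minBlock : ∀ B → (∀ R → R 0 ≡ k → R 1 ≡ D → R 2 ≡ W → Triple 3 4 R M Goal B) → Triple 3 0 M M Goal (4 + B)
  minBlock B K1 = mul-rule refl tt tt tt (jle-rule refl tt tt
    (λ le → Triple-weaken (K1 _ refl refl (sym (m≤n⇒m⊓n≡m le))) (m≤n+m B 2))
    (λ lt → sub-rule refl tt tt tt (add-rule refl tt tt tt (K1 _ refl refl
       (trans (cong (_+ D) (n∸n≡0 c)) (sym (m≥n⇒m⊓n≡n (<⇒≤ lt))))))))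

  totalCost : ℕ
  totalCost = 4 + (20 + (D * 10 + 2 + (5 + (18 + (d * costPerItem + 1 + 3)))))

  dpProgram-triple : (∀ m → m 0 ≡ k + dp d 0 W → Goal ⟨ 87 , m ⟩) → Reaches ⟨ 0 , M ⟩ Goal totalCost
  dpProgram-triple halt = execute (minBlock _ (λ R e0 e1 e2 → setupBlock R _ e0 e1 e2 (λ R' h' eA inv → reloadBlock R' h' _ eA inv (λ R'' h'' fx _ tab → finish halt R'' h'' fx tab))))
     M (represents (λ x → if-same x (x <ᵇ 3)))
    where
    if-same : ∀ x b → M x ≡ (if b then M x else M x)
    if-same x true = refl
    if-same x false = refl

totalCost-expanded : ∀ D d c → 4 + (20 + (D * 10 + 2 + (5 + (18 + (d * c + 1 + 3))))) ≡ d * c + (53 + D * 10)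
totalCost-expanded = solve-∀

totalCost-polynomial : ∀ d k → d * (5 + suc (d * k) * (k * 12 + 10)) + (53 + d * k * 10) ≡
                       53 + 22 * (d * k) + 15 * d + 12 * ((d * k) * (d * k)) + 10 * ((d * k) * d)
totalCost-polynomial = solve-∀

n≤1+n*n : ∀ n → n ≤ 1 + n * n
n≤1+n*n zero = z≤n
n≤1+n*n (suc n) = ≤-trans (m≤m*n (suc n) (suc n)) (n≤1+n _)

quadratic≤200[1+x²] : ∀ x → 53 + 22 * x + 15 * x + 12 * (x * x) + 10 * (x * x) ≤ 200 * (1 + x * x)
quadratic≤200[1+x²] x = begin
  53 + 22 * x + 15 * x + 12 * (x * x) + 10 * (x * x)     ≡⟨ collect x ⟩
  53 + 37 * x + 22 * (x * x)                            ≤⟨ +-monoˡ-≤ (22 * (x * x)) (+-monoʳ-≤ 53 (*-monoʳ-≤ 37 (n≤1+n*n x))) ⟩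
  53 + 37 * (1 + x * x) + 22 * (x * x)                  ≤⟨ m≤m+n _ (110 + 141 * (x * x)) ⟩
  53 + 37 * (1 + x * x) + 22 * (x * x) + (110 + 141 * (x * x)) ≡⟨ split x ⟩
  200 * (1 + x * x)                                     ∎
  where
  open ≤-Reasoning
  collect : ∀ x → 53 + 22 * x + 15 * x + 12 * (x * x) + 10 * (x * x) ≡ 53 + 37 * x + 22 * (x * x)
  collect = solve-∀
  split : ∀ x → 53 + 37 * (1 + x * x) + 22 * (x * x) + (110 + 141 * (x * x)) ≡ 200 * (1 + x * x)
  split = solve-∀

totalCost≤ : ∀ d k W → 1 ≤ k → W ≤ d * k →
             4 + (20 + (d * k * 10 + 2 + (5 + (18 + (d * (5 + suc W * (k * 12 + 10)) + 1 + 3))))) ≤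
             200 * (1 + k * k * d * d)
totalCost≤ d k W 1≤k W≤dk = begin
  4 + (20 + (x * 10 + 2 + (5 + (18 + (d * (5 + suc W * (k * 12 + 10)) + 1 + 3)))))
    ≡⟨ totalCost-expanded x d (5 + suc W * (k * 12 + 10)) ⟩
  d * (5 + suc W * (k * 12 + 10)) + (53 + x * 10)
    ≤⟨ +-monoˡ-≤ (53 + x * 10) (*-monoʳ-≤ d (+-monoʳ-≤ 5 (*-monoˡ-≤ (k * 12 + 10) (s≤s W≤dk)))) ⟩
  d * (5 + suc x * (k * 12 + 10)) + (53 + x * 10)
    ≡⟨ totalCost-polynomial d k ⟩
  53 + 22 * x + 15 * d + 12 * (x * x) + 10 * (x * d)
    ≤⟨ +-mono-≤ (+-monoˡ-≤ (12 * (x * x)) (+-monoʳ-≤ (53 + 22 * x) (*-monoʳ-≤ 15 d≤x))) (*-monoʳ-≤ 10 (*-monoʳ-≤ x d≤x)) ⟩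
  53 + 22 * x + 15 * x + 12 * (x * x) + 10 * (x * x)
    ≤⟨ quadratic≤200[1+x²] x ⟩
  200 * (1 + x * x)
    ≡⟨ cong (λ z → 200 * (1 + z)) (square-reorder d k) ⟩
  200 * (1 + k * k * d * d) ∎
  where
  open ≤-Reasoning
  x = d * k
  d≤x : d ≤ x
  d≤x = subst (_≤ x) (*-identityʳ d) (*-monoʳ-≤ d 1≤k)
  square-reorder : ∀ d k → (d * k) * (d * k) ≡ k * k * d * d
  square-reorder = solve-∀

dpProgram-correct : ∀ (k d c : ℕ) (g : Fin d → Fin k → ℕ) → 1 ≤ k → NonDecreasing k d g →
                    ∀ (M : Memory) → Encodes k d c g M →
                    Σ ℕ (λ t → t ≤ 200 * (1 + k * k * d * d) ×
                               Halted dpProgram (run dpProgram t ⟨ 0 , M ⟩) ×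
                               IsOptimalValue k d c g (mem (run dpProgram t ⟨ 0 , M ⟩) 0))
dpProgram-correct .(M 0) .(M 1) .(M 2) g 1≤k _ M (refl , refl , refl , profits , input≡0) =
  steps , ≤-trans steps≤ (totalCost≤ d k W 1≤k (m⊓n≤n c D)) , reached
  where
  Solved : Config → Set
  Solved cfg = Halted dpProgram cfg × IsOptimalValue (M 0) (M 1) (M 2) g (mem cfg 0)
  open Verification M 1≤k input≡0 Solved
  halt : ∀ m → m 0 ≡ k + dp d 0 W → Solved ⟨ 87 , m ⟩
  halt m eq = refl , subst (IsOptimalValue k d c g) (sym eq) (dp-solves d c g profits)
  open Reaches (dpProgram-triple halt)

lemma1 : Σ Program (λ P → Σ ℕ (λ C →
    ∀ (k d c : ℕ) (g : Fin d → Fin k → ℕ) → 1 ≤ k → NonDecreasing k d g →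
    ∀ (M : Memory) → Encodes k d c g M →
    Σ ℕ (λ t → t ≤ C * (1 + k * k * d * d) ×
    Halted P (run P t ⟨ 0 , M ⟩) ×
    IsOptimalValue k d c g (mem (run P t ⟨ 0 , M ⟩) 0))))
lemma1 = dpProgram , 200 , dpProgram-correct
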